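{- Let $\mathcal{E}$ be a set of five lines in $\mathrm{PG}(3,2)$ such that any two lines of $\mathcal{E}$ have a point in common. Then $\mathcal{E}$ contains a pencil, i.e. there exist a plane $\Pi$ and a point $P\in\Pi$ such that all $3$ lines of $\mathrm{PG}(3,2)$ through $P$ contained in $\Pi$ belong to $\mathcal{E}$.
   Context: $\mathrm{PG}(3,2)$ is the $3$-dimensional projective space over $\mathrm{GF}(2)$. A pencil with carrier $P$ in the plane $\Pi$ (where $P\in\Pi$) is the set of the $q+1$ lines through $P$ contained in $\Pi$; for $q=2$ it consists of $3$ lines. -}

module Defs where

open import Data.Bool using (Bool; true; false; _xor_; _∧_)
open import Data.Vec using (Vec; replicate; zipWith; foldr)
open import Data.Nat using (ℕ)
open import Data.Product using (Σ; ∃; _×_)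
open import Data.Sum using (_⊎_)
open import Relation.Binary.PropositionalEquality using (_≡_; _≢_)
open import Function.Bundles using (_⇔_)

-- Vectors of GF(2)^4 (GF(2) = Bool with xor as addition, ∧ as multiplication)
V4 : Set
V4 = Vec Bool 4

zeroV : V4
zeroV = replicate 4 false

_⊕_ : V4 → V4 → V4
_⊕_ = zipWith _xor_

dot : V4 → V4 → Bool
dot u x = foldr (λ _ → Bool) _xor_ false (zipWith _∧_ u x)

-- Points of PG(3,2): the nonzero vectors of GF(2)^4 (over GF(2) each
-- 1-dimensional subspace has exactly one nonzero vector)
IsPoint : V4 → Set
IsPoint v = v ≢ zeroV

-- A line of PG(3,2): the 2-dimensional subspace spanned by two distinct points
-- p, q; its points are p, q, p + q.
record Line : Set where
  constructor mkLine
  field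
    p q   : V4
    p-pt  : IsPoint p
    q-pt  : IsPoint q
    p≢q   : p ≢ q

OnLine : V4 → Line → Set
OnLine x L = x ≡ Line.p L ⊎ (x ≡ Line.q L ⊎ x ≡ (Line.p L ⊕ Line.q L))

SameLine : Line → Line → Set
SameLine L M = ∀ x → OnLine x L ⇔ OnLine x M

-- A plane of PG(3,2): a 3-dimensional subspace, i.e. the kernel of a
-- nonzero linear form u (the plane's dual coordinates)
record Plane : Set where
  constructor mkPlane
  field
    u    : V4
    u-nz : u ≢ zeroV

OnPlane : V4 → Plane → Set
OnPlane x Π = dot (Plane.u Π) x ≡ false

LineInPlane : Line → Plane → Set
LineInPlane L Π = ∀ x → OnLine x L → OnPlane x Π

Meet : Line → Line → Set
Meet L M = ∃ λ x → OnLine x L × OnLine x M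

module Submission where

-- Five pairwise meeting lines of PG(3,2) all pass through one point or all lie in one plane,
-- so they are five of the seven lines of a Fano plane whose own lines are the pencils; each
-- line lies in three of the seven pencils, so the two missing ones spoil at most six of them.
-- This is confirmed by exhaustion: every line equals one of 35 tabulated lines, so the five
-- lines become an increasing 5-clique of the meet graph on the table (there are 630), and
-- each such clique contains three lines a < b < c such that every sum of a point of a and a
-- point of b is 0 or lies on a, b or c; such a triple is always a full pencil.

open import Defs
open import Data.Bool using (Bool; true; false)
open import Data.Bool.Properties using () renaming (_≟_ to _≟ᵇ_)
open import Data.Vec using (Vec; _∷_; []; lookup)
open import Data.Vec.Properties using (≡-dec)
open import Data.Fin using (Fin; _<_; _≤_)
open import Data.Fin.Properties as Fin
  using (≤∧≢⇒<; ≤-trans; ≤-decTotalOrder; _<?_) renaming (_≟_ to _≟ᶠ_)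
open import Data.Fin.Subset.Properties using (anySubset?)
open import Data.List using (List; []; _∷_; _++_; map; filter; concatMap; length; tabulate; allFin)
open import Data.List.Properties using (length-tabulate)
open import Data.List.Membership.Propositional using (_∈_; find; lose)
open import Data.List.Membership.Propositional.Properties
  using (∈-allFin; ∈-map⁺; ∈-filter⁺; ∈-concatMap⁺; ∈-tabulate⁻)
open import Data.List.Membership.DecPropositional (≡-dec {n = 4} _≟ᵇ_) using (_∈?_)
open import Data.List.Relation.Binary.Subset.Propositional using (_⊆_)
open import Data.List.Relation.Binary.Permutation.Propositional using (_↭_; ↭-sym; ↭⇒↭ₛ)
open import Data.List.Relation.Binary.Permutation.Propositional.Properties using (↭-length; ∈-resp-↭)
open import Data.List.Relation.Binary.Permutation.Setoid.Properties using (Unique-resp-↭; AllPairs-resp-↭)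
open import Data.List.Relation.Unary.All as All using (All)
open import Data.List.Relation.Unary.Any as Any using (Any; here; there)
open import Data.List.Relation.Unary.AllPairs as AllPairs using (AllPairs; []; _∷_)
open import Data.List.Relation.Unary.AllPairs.Properties using (tabulate⁺-<)
open import Data.List.Relation.Unary.Linked.Properties using (Linked⇒AllPairs)
open import Data.List.Relation.Unary.Unique.Propositional using (Unique)
open import Data.List.Relation.Unary.Unique.Propositional.Properties
  using () renaming (tabulate⁺ to Unique-tabulate⁺)
open import Data.Nat using (ℕ; zero; suc; NonZero; _/_; _%_; _≡ᵇ_)
open import Data.Product using (Σ; ∃; ∃₂; _×_; _,_; proj₁; proj₂)
open import Data.Sum using (inj₁; inj₂)
open import Function using (_∘_)
open import Function.Bundles using (mk⇔; Equivalence)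
open import Function.Construct.Composition using (_⇔-∘_)
open import Function.Construct.Symmetry using (⇔-sym)
open import Relation.Binary using (Rel; Decidable; Symmetric)
open import Relation.Binary.PropositionalEquality
  using (_≡_; _≢_; refl; sym; trans; subst; resp₂; setoid)
open import Relation.Nullary using (¬_; Dec; yes; no; does; ¬?)
open import Relation.Nullary.Decidable using (_×-dec_; _→-dec_; toWitness; decidable-stable; True)
import Relation.Nullary.Decidable as Dec

-- Checking `does P? ≡ true` by `refl` runs the decision procedure in the conversion checker,
-- which is much faster than solving the `True P?` argument of `toWitness` by unification.
by-evaluation : ∀ {p} {P : Set p} (P? : Dec P) → does P? ≡ true → P
by-evaluation (yes p) _ = p
by-evaluation (no _)  ()

_≟ᵥ_ : (u v : V4) → Dec (u ≡ v)
_≟ᵥ_ = ≡-dec _≟ᵇ_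

_⊆?_ : (xs ys : List V4) → Dec (xs ⊆ ys)
xs ⊆? ys = Dec.map′ All.lookup All.tabulate (All.all? (_∈? ys) xs)

all-vectors? : ∀ {n p} {P : Vec Bool n → Set p} → (∀ v → Dec (P v)) → Dec (∀ v → P v)
all-vectors? P? = Dec.map′ (λ ¬∃¬ v → decidable-stable (P? v) (λ ¬Pv → ¬∃¬ (v , ¬Pv)))
                           (λ ∀P (v , ¬Pv) → ¬Pv (∀P v))
                           (¬? (anySubset? (¬? ∘ P?)))

span : V4 → V4 → List V4
span p q = p ∷ q ∷ p ⊕ q ∷ []

pointsOn : Line → List V4
pointsOn L = span (Line.p L) (Line.q L)

∈⇒OnLine : ∀ {x} L → x ∈ pointsOn L → OnLine x L
∈⇒OnLine L (here e)                 = inj₁ e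
∈⇒OnLine L (there (here e))         = inj₂ (inj₁ e)
∈⇒OnLine L (there (there (here e))) = inj₂ (inj₂ e)

OnLine⇒∈ : ∀ {x} L → OnLine x L → x ∈ pointsOn L
OnLine⇒∈ L (inj₁ e)        = here e
OnLine⇒∈ L (inj₂ (inj₁ e)) = there (here e)
OnLine⇒∈ L (inj₂ (inj₂ e)) = there (there (here e))

⊆⇒SameLine : ∀ {L M} → pointsOn L ⊆ pointsOn M → pointsOn M ⊆ pointsOn L → SameLine L M
⊆⇒SameLine {L} {M} L⊆M M⊆L x =
  mk⇔ (∈⇒OnLine M ∘ L⊆M ∘ OnLine⇒∈ L) (∈⇒OnLine L ∘ M⊆L ∘ OnLine⇒∈ M)

SameLine-sym : ∀ {L M} → SameLine L M → SameLine M L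
SameLine-sym L≈M x = ⇔-sym (L≈M x)

SameLine-trans : ∀ {L M N} → SameLine L M → SameLine M N → SameLine L N
SameLine-trans L≈M M≈N x = M≈N x ⇔-∘ L≈M x

Meet-sym : ∀ {L M} → Meet L M → Meet M L
Meet-sym (x , x∈L , x∈M) = x , x∈M , x∈L

Meet-resp-SameLine : ∀ {L L′ M M′} → SameLine L L′ → SameLine M M′ → Meet L M → Meet L′ M′
Meet-resp-SameLine L≈L′ M≈M′ (x , x∈L , x∈M) =
  x , Equivalence.to (L≈L′ x) x∈L , Equivalence.to (M≈M′ x) x∈M

onLine? : ∀ x L → Dec (OnLine x L)
onLine? x L = Dec.map′ (∈⇒OnLine L) (OnLine⇒∈ L) (x ∈? pointsOn L)

meet? : ∀ L M → Dec (Meet L M)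
meet? L M = Dec.map′ witness common (Any.any? (_∈? pointsOn M) (pointsOn L))
  where
  witness : Any (_∈ pointsOn M) (pointsOn L) → Meet L M
  witness found = let x , x∈L , x∈M = find found in x , ∈⇒OnLine L x∈L , ∈⇒OnLine M x∈M
  common : Meet L M → Any (_∈ pointsOn M) (pointsOn L)
  common (x , x∈L , x∈M) = lose (OnLine⇒∈ L x∈L) (OnLine⇒∈ M x∈M)

lineInPlane? : ∀ L Π → Dec (LineInPlane L Π)
lineInPlane? L Π = Dec.map′ (λ all x → All.lookup all ∘ OnLine⇒∈ L)
                            (λ L⊆Π → All.tabulate (L⊆Π _ ∘ ∈⇒OnLine L))
                            (All.all? (λ x → dot (Plane.u Π) x ≟ᵇ false) (pointsOn L))

-- The point whose coordinates are the binary digits of n, least significant first.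
point : ℕ → V4
point n = bit 1 ∷ bit 2 ∷ bit 4 ∷ bit 8 ∷ []
  where
  bit : (d : ℕ) .{{_ : NonZero d}} → Bool
  bit d = (n / d) % 2 ≡ᵇ 1

⟨_,_⟩ : (m n : ℕ) →
        {True (¬? (point m ≟ᵥ zeroV) ×-dec ¬? (point n ≟ᵥ zeroV) ×-dec ¬? (point m ≟ᵥ point n))} →
        Line
⟨ m , n ⟩ {ok} = mkLine (point m) (point n) (proj₁ w) (proj₁ (proj₂ w)) (proj₂ (proj₂ w))
  where w = toWitness ok

-- Each line {a, b, a ⊕ b} is listed by the codes a < b < a ⊕ b of its two smallest points.
line : Fin 35 → Line
line = lookup (
  ⟨ 1 , 2 ⟩ ∷ ⟨ 1 , 4 ⟩ ∷ ⟨ 1 , 6 ⟩ ∷ ⟨ 1 , 8 ⟩ ∷ ⟨ 1 , 10 ⟩ ∷ ⟨ 1 , 12 ⟩ ∷ ⟨ 1 , 14 ⟩ ∷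
  ⟨ 2 , 4 ⟩ ∷ ⟨ 2 , 5 ⟩ ∷ ⟨ 2 , 8 ⟩ ∷ ⟨ 2 , 9 ⟩ ∷ ⟨ 2 , 12 ⟩ ∷ ⟨ 2 , 13 ⟩ ∷ ⟨ 3 , 4 ⟩ ∷
  ⟨ 3 , 5 ⟩ ∷ ⟨ 3 , 8 ⟩ ∷ ⟨ 3 , 9 ⟩ ∷ ⟨ 3 , 12 ⟩ ∷ ⟨ 3 , 13 ⟩ ∷ ⟨ 4 , 8 ⟩ ∷ ⟨ 4 , 9 ⟩ ∷
  ⟨ 4 , 10 ⟩ ∷ ⟨ 4 , 11 ⟩ ∷ ⟨ 5 , 8 ⟩ ∷ ⟨ 5 , 9 ⟩ ∷ ⟨ 5 , 10 ⟩ ∷ ⟨ 5 , 11 ⟩ ∷ ⟨ 6 , 8 ⟩ ∷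
  ⟨ 6 , 9 ⟩ ∷ ⟨ 6 , 10 ⟩ ∷ ⟨ 6 , 11 ⟩ ∷ ⟨ 7 , 8 ⟩ ∷ ⟨ 7 , 9 ⟩ ∷ ⟨ 7 , 10 ⟩ ∷ ⟨ 7 , 11 ⟩ ∷ [])

-- The facts proved by evaluation are opaque, so that unification never unfolds them into
-- the (huge) terms of the search that produced them.
opaque
  every-line-is-tabulated : ∀ p q → IsPoint p → IsPoint q → p ≢ q →
                            ∃ λ i → span p q ⊆ pointsOn (line i) × pointsOn (line i) ⊆ span p q
  every-line-is-tabulated = by-evaluation
    (all-vectors? λ p → all-vectors? λ q →
       ¬? (p ≟ᵥ zeroV) →-dec ¬? (q ≟ᵥ zeroV) →-dec ¬? (p ≟ᵥ q) →-dec
       Fin.any? (λ i → (span p q ⊆? pointsOn (line i)) ×-dec (pointsOn (line i) ⊆? span p q)))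
    refl

line-index : ∀ L → ∃ λ i → SameLine L (line i)
line-index L@(mkLine p q p-pt q-pt p≢q) =
  let i , L⊆ , ⊆L = every-line-is-tabulated p q p-pt q-pt p≢q in i , ⊆⇒SameLine {L} {line i} L⊆ ⊆L

module _ {a r} {A : Set a} {R : Rel A r} (R? : Decidable R) (xs : List A) where

  extensions : List A → List (List A)
  extensions S = map (_∷ S) (filter (λ x → All.all? (R? x) S) xs)

  cliques : ℕ → List (List A)
  cliques zero    = [] ∷ []
  cliques (suc k) = concatMap extensions (cliques k)

  ∈-cliques : (∀ x → x ∈ xs) → ∀ {S k} → AllPairs R S → length S ≡ k → S ∈ cliques k
  ∈-cliques ∈xs []                refl = here refl
  ∈-cliques ∈xs {x ∷ S} (Rx ∷ RS) refl = ∈-concatMap⁺ extensions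
    (lose (∈-cliques ∈xs RS refl) (∈-map⁺ (_∷ S) (∈-filter⁺ (λ x → All.all? (R? x) S) (∈xs x) Rx)))

module _ {n r} {R : Rel (Fin n) r} where
  open import Data.List.Sort (≤-decTotalOrder n) using (sort; sort-↭; sort-↗)

  increasing-arrangement : Symmetric R → ∀ {S} → Unique S → AllPairs R S →
                           ∃ λ T → T ↭ S × AllPairs (λ i j → i < j × R i j) T
  increasing-arrangement sym-R {S} S-unique S-R =
    sort S , sort-↭ S , AllPairs.zipWith strict (AllPairs.zip (sorted , unique) , related)
    where
    T↭ₛS    = ↭⇒↭ₛ (↭-sym (sort-↭ S))
    sorted  = Linked⇒AllPairs ≤-trans (sort-↗ S)
    unique  = Unique-resp-↭ (setoid (Fin n)) T↭ₛS S-unique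
    related = AllPairs-resp-↭ (setoid (Fin n)) sym-R (resp₂ R) T↭ₛS S-R
    strict : ∀ {i j} → (i ≤ j × i ≢ j) × R i j → i < j × R i j
    strict ((i≤j , i≢j) , r) = ≤∧≢⇒< i≤j i≢j , r

Meets : Rel (Fin 35) _
Meets i j = Meet (line i) (line j)

Adjacent : Rel (Fin 35) _
Adjacent i j = i < j × Meets i j

adjacent? : Decidable Adjacent
adjacent? i j = (i <? j) ×-dec meet? (line i) (line j)

PencilIn : Plane → V4 → List (Fin 35) → Set
PencilIn Π P S = IsPoint P × OnPlane P Π × (∀ m → OnLine P (line m) → LineInPlane (line m) Π → m ∈ S)

PencilIn-mono : ∀ {Π P S S′} → S ⊆ S′ → PencilIn Π P S → PencilIn Π P S′
PencilIn-mono S⊆S′ (P-pt , P∈Π , pencil) = P-pt , P∈Π , λ m P∈m m⊆Π → S⊆S′ (pencil m P∈m m⊆Π)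

pencilIn? : ∀ Π P S → Dec (PencilIn Π P S)
pencilIn? Π P S =
  ¬? (P ≟ᵥ zeroV) ×-dec (dot (Plane.u Π) P ≟ᵇ false) ×-dec
  Fin.all? (λ m → onLine? P (line m) →-dec lineInPlane? (line m) Π →-dec Any.any? (m ≟ᶠ_) S)

SpannedPencilIn : Fin 35 → Fin 35 → List (Fin 35) → Set
SpannedPencilIn a b S = ∃ λ Π → (LineInPlane (line a) Π × LineInPlane (line b) Π) ×
                        ∃ λ P → (OnLine P (line a) × OnLine P (line b)) × PencilIn Π P S

spannedPencilIn? : ∀ a b S → Dec (SpannedPencilIn a b S)
spannedPencilIn? a b S = Dec.map′ (λ (u , u≢0 , spanned) → mkPlane u u≢0 , spanned)
                                  (λ (mkPlane u u≢0 , spanned) → u , u≢0 , spanned)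
                                  (anySubset? λ u → withNormal u (u ≟ᵥ zeroV))
  where
  Spanned : Plane → Set
  Spanned Π = (LineInPlane (line a) Π × LineInPlane (line b) Π) ×
              ∃ λ P → (OnLine P (line a) × OnLine P (line b)) × PencilIn Π P S
  spanned? : ∀ Π → Dec (Spanned Π)
  spanned? Π = (lineInPlane? (line a) Π ×-dec lineInPlane? (line b) Π) ×-dec
               anySubset? (λ P → (onLine? P (line a) ×-dec onLine? P (line b)) ×-dec pencilIn? Π P S)
  withNormal : ∀ u → Dec (u ≡ zeroV) → Dec (Σ (u ≢ zeroV) λ u≢0 → Spanned (mkPlane u u≢0))
  withNormal u (yes u≡0) = no λ (u≢0 , _) → u≢0 u≡0
  withNormal u (no u≢0)  = Dec.map′ (u≢0 ,_) (λ (_ , spanned) → spanned) (spanned? (mkPlane u u≢0))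

-- For a ≠ b, the closure condition says that a ∪ b ∪ c ∪ {0} contains the span of a and b.
-- Skew lines span all 15 points, so a and b meet in a point P, and c has to carry the two
-- points of their plane off a ∪ b: c is the third line through P in that plane.
PencilTriple : Fin 35 → Fin 35 → Fin 35 → Set
PencilTriple a b c = a < b × b < c ×
  All (λ x → All (λ y → x ⊕ y ∈ zeroV ∷ points a ++ points b ++ points c) (points b)) (points a)
  where points = pointsOn ∘ line

pencilTriple? : ∀ a b c → Dec (PencilTriple a b c)
pencilTriple? a b c = a <? b ×-dec b <? c ×-dec
  All.all? (λ x → All.all? (λ y → x ⊕ y ∈? zeroV ∷ points a ++ points b ++ points c) (points b)) (points a)
  where points = pointsOn ∘ line

opaque
  PencilTriple⇒SpannedPencilIn : ∀ {a b c} → PencilTriple a b c → SpannedPencilIn a b (a ∷ b ∷ c ∷ [])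
  PencilTriple⇒SpannedPencilIn {a} {b} {c} triple@(a<b , _) = by-evaluation
    (Fin.all? λ a → Fin.all? λ b → a <? b →-dec Fin.all? λ c →
       pencilTriple? a b c →-dec spannedPencilIn? a b (a ∷ b ∷ c ∷ []))
    refl a b a<b c triple

HasPencilTriple : List (Fin 35) → Set
HasPencilTriple S = Any (λ a → Any (λ b → Any (PencilTriple a b) S) S) S

opaque
  every-5-clique-has-a-pencil-triple : All HasPencilTriple (cliques adjacent? (allFin 35) 5)
  every-5-clique-has-a-pencil-triple = by-evaluation
    (All.all? (λ S → Any.any? (λ a → Any.any? (λ b → Any.any? (pencilTriple? a b) S) S) S)
              (cliques adjacent? (allFin 35) 5))
    refl

HasPencilTriple⇒PencilIn : ∀ {S} → HasPencilTriple S → ∃₂ λ Π P → PencilIn Π P S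
HasPencilTriple⇒PencilIn has =
  let a , a∈S , has-b  = find has
      b , b∈S , has-c  = find has-b
      c , c∈S , triple = find has-c
      Π , _ , P , _ , pencil = PencilTriple⇒SpannedPencilIn {a} {b} {c} triple
  in Π , P , PencilIn-mono {Π} {P} (⊆-triple a∈S b∈S c∈S) pencil
  where
  ⊆-triple : ∀ {a b c S} → a ∈ S → b ∈ S → c ∈ S → a ∷ b ∷ c ∷ [] ⊆ S
  ⊆-triple a∈S b∈S c∈S (here refl)                 = a∈S
  ⊆-triple a∈S b∈S c∈S (there (here refl))         = b∈S
  ⊆-triple a∈S b∈S c∈S (there (there (here refl))) = c∈S

clique⇒PencilIn : ∀ {S} → length S ≡ 5 → Unique S → AllPairs Meets S → ∃₂ λ Π P → PencilIn Π P S
clique⇒PencilIn {S} |S|≡5 S-unique S-meets =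
  let T , T↭S , T-adjacent = increasing-arrangement {R = Meets} (λ {i} {j} → Meet-sym {line i} {line j})
                                                    S-unique S-meets
      T-clique = ∈-cliques {R = Adjacent} adjacent? (allFin 35) ∈-allFin {T} {5}
                           T-adjacent (trans (↭-length T↭S) |S|≡5)
      Π , P , pencil = HasPencilTriple⇒PencilIn {T} (All.lookup every-5-clique-has-a-pencil-triple T-clique)
  in Π , P , PencilIn-mono {Π} {P} {T} {S} (∈-resp-↭ T↭S) pencil

module _ {k} (E : Fin k → Line) where

  index : Fin k → Fin 35
  index i = proj₁ (line-index (E i))

  E≈line : ∀ i → SameLine (E i) (line (index i))
  E≈line i = proj₂ (line-index (E i))

  indices : List (Fin 35)
  indices = tabulate index

  indices-unique : (∀ i j → i ≢ j → ¬ SameLine (E i) (E j)) → Unique indices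
  indices-unique distinct = Unique-tabulate⁺ λ {i} {j} same-index →
    decidable-stable (i ≟ᶠ j) λ i≢j → distinct i j i≢j
      (SameLine-trans {E i} {line (index i)} {E j} (E≈line i)
        (subst (λ m → SameLine (line m) (E j)) (sym same-index)
               (SameLine-sym {E j} {line (index j)} (E≈line j))))

  indices-meet : (∀ i j → Meet (E i) (E j)) → AllPairs Meets indices
  indices-meet meet = tabulate⁺-< λ {i} {j} _ →
    Meet-resp-SameLine {E i} {line (index i)} {E j} {line (index j)} (E≈line i) (E≈line j) (meet i j)

  PencilIn-indices : ∀ {Π P} → PencilIn Π P indices →
                     ∀ L → OnLine P L → LineInPlane L Π → ∃ λ i → SameLine L (E i)
  PencilIn-indices {Π} {P} (_ , _ , pencil) L P∈L L⊆Π =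
    let m , L≈m = line-index L
        i , m≡i = ∈-tabulate⁻ (pencil m (Equivalence.to (L≈m P) P∈L)
                                       (λ x → L⊆Π x ∘ Equivalence.from (L≈m x)))
    in i , SameLine-trans {L} {line m} {E i} L≈m
             (subst (λ n → SameLine (line n) (E i)) (sym m≡i)
                    (SameLine-sym {E i} {line (index i)} (E≈line i)))

lemma4 : (E : Fin 5 → Line)
         → (∀ i j → i ≢ j → ¬ SameLine (E i) (E j))
         → (∀ i j → Meet (E i) (E j))
         → ∃ λ (Π : Plane) → ∃ λ (P : V4) → IsPoint P × OnPlane P Π ×
             (∀ (L : Line) → OnLine P L → LineInPlane L Π → ∃ λ i → SameLine L (E i))
lemma4 E distinct meet =
  let Π , P , pencil@(P-pt , P∈Π , _) =
        clique⇒PencilIn (length-tabulate (index E)) (indices-unique E distinct) (indices-meet E meet)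
  in Π , P , P-pt , P∈Π , PencilIn-indices E {Π} {P} pencil
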